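{- For every finite simple graph $G$, $\chi_2(G)-\chi(G)\le \alpha'(G)+3$.
   Context: $\chi(G)$ is the chromatic number of $G$ and $\alpha'(G)$ is the matching number (maximum size of a matching) of $G$. A dynamic coloring of $G$ is a proper vertex coloring such that for every vertex $v$ of degree at least $2$, the neighbours of $v$ receive at least two different colors; $\chi_2(G)$ is the smallest number of colors in a dynamic coloring of $G$. -}

module Defs where

open import Data.Nat using (ℕ; _≤_)
open import Data.Fin using (Fin)
open import Data.Bool using (Bool; true; false)
open import Data.Sum using (_⊎_; [_,_])
open import Data.Product using (Σ; ∃; _×_; _,_)
open import Relation.Binary.PropositionalEquality using (_≡_; _≢_)
open import Function.Definitions using (Injective)

record Graph (n : ℕ) : Set where
  field
    adj   : Fin n → Fin n → Bool
    sym   : ∀ u v → adj u v ≡ adj v u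
    irrefl : ∀ v → adj v v ≡ false

open Graph public

Adj : ∀ {n} → Graph n → Fin n → Fin n → Set
Adj G u v = adj G u v ≡ true

IsProperColoring : ∀ {n k} → Graph n → (Fin n → Fin k) → Set
IsProperColoring G c = ∀ u v → Adj G u v → c u ≢ c v

Colorable : ∀ {n} → Graph n → ℕ → Set
Colorable G k = Σ (_ → Fin k) λ c → IsProperColoring G c

DegreeAtLeast2 : ∀ {n} → Graph n → Fin n → Set
DegreeAtLeast2 G v = ∃ λ u → ∃ λ w → Adj G v u × Adj G v w × u ≢ w

IsDynamicColoring : ∀ {n k} → Graph n → (Fin n → Fin k) → Set
IsDynamicColoring G c =
  IsProperColoring G c ×
  (∀ v → DegreeAtLeast2 G v →
     ∃ λ u → ∃ λ w → Adj G v u × Adj G v w × c u ≢ c w)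

DynColorable : ∀ {n} → Graph n → ℕ → Set
DynColorable G k = Σ (_ → Fin k) λ c → IsDynamicColoring G c

IsChromaticNumber : ∀ {n} → Graph n → ℕ → Set
IsChromaticNumber G k = Colorable G k × (∀ j → Colorable G j → k ≤ j)

IsDynamicChromaticNumber : ∀ {n} → Graph n → ℕ → Set
IsDynamicChromaticNumber G k = DynColorable G k × (∀ j → DynColorable G j → k ≤ j)

HasMatching : ∀ {n} → Graph n → ℕ → Set
HasMatching {n} G m =
  Σ (Fin m → Fin n) λ l → Σ (Fin m → Fin n) λ r →
    (∀ i → Adj G (l i) (r i)) × Injective _≡_ _≡_ [ l , r ]

IsMatchingNumber : ∀ {n} → Graph n → ℕ → Set
IsMatchingNumber G m = HasMatching G m × (∀ j → HasMatching G j → j ≤ m)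

module Submission where

-- Fix a proper colouring c with χ colours and a maximum matching with edges
-- (l i , r i), i < m = α'(G).  We build a dynamic colouring of G whose palette
-- consists of the χ old colours, one private colour per matching edge and
-- three extra colours; it embeds into Fin (χ + m + 3), which gives the bound.
--
-- Maximality of the matching is used twice: the unmatched ("free") vertices
-- are independent, and there is no augmenting path of length three.  Each
-- private colour is put on exactly one endpoint of its edge; a vertex of degree
-- at least two adjacent to a privately coloured vertex automatically sees two
-- colours.  Free vertices get an extra colour, and the right endpoints of
-- "stranded" edges (for which no private colour can help their left endpoint)
-- get extra colours taken from a proper 3-colouring of an auxiliary functional
-- digraph on the edges.

open import Defs hiding (sym)
open import Data.Nat using (ℕ; zero; suc; s≤s; _≤_; _<_; _+_; _∸_)
import Data.Nat.Properties as ℕ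
open import Data.Fin as Fin using (Fin; zero; suc; toℕ; join; splitAt)
import Data.Fin.Properties as FinP
open import Data.Bool using (Bool; true; false; not)
import Data.Bool.Properties as BoolP
open import Data.Sum using (_⊎_; inj₁; inj₂; [_,_])
open import Data.Sum.Properties using (inj₁-injective; inj₂-injective)
open import Data.Product using (Σ; ∃; _×_; _,_; proj₁; proj₂)
open import Data.Maybe using (Maybe; just; nothing; maybe′)
open import Data.Empty using (⊥-elim)
open import Relation.Nullary using (¬_; Dec; yes; no)
open import Relation.Nullary.Decidable using (_×-dec_; _⊎-dec_; ¬?)
open import Relation.Binary.Definitions using (tri<; tri≈; tri>)
open import Relation.Binary.PropositionalEquality
  using (_≡_; _≢_; refl; sym; trans; cong; subst; module ≡-Reasoning)
open import Function.Definitions using (Injective)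

adj-sym : ∀ {n} (G : Graph n) {u v} → Adj G u v → Adj G v u
adj-sym G {u} {v} p = trans (Graph.sym G v u) p

adj⇒≢ : ∀ {n} (G : Graph n) {u v} → Adj G u v → u ≢ v
adj⇒≢ G {u} p refl with trans (sym (Graph.irrefl G u)) p
... | ()

adj? : ∀ {n} (G : Graph n) u v → Dec (Adj G u v)
adj? G u v = adj G u v BoolP.≟ true

other-neighbour : ∀ {n} (G : Graph n) {v} → DegreeAtLeast2 G v →
  ∀ x → ∃ λ y → Adj G v y × y ≢ x
other-neighbour G (a , b , va , vb , a≢b) x with a Fin.≟ x
... | yes refl = b , vb , λ b≡a → a≢b (sym b≡a)
... | no a≢x = a , va , a≢x

-- Colourings with values in an arbitrary palette A.  For A = Fin k these are
-- definitionally the notions of Defs.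
module Colourings {n} (G : Graph n) {A : Set} where

  Proper : (Fin n → A) → Set
  Proper col = ∀ u v → Adj G u v → col u ≢ col v

  SeesTwoColours : (Fin n → A) → Fin n → Set
  SeesTwoColours col v = ∃ λ u → ∃ λ w → Adj G v u × Adj G v w × col u ≢ col w

  Dynamic : (Fin n → A) → Set
  Dynamic col = Proper col × (∀ v → DegreeAtLeast2 G v → SeesTwoColours col v)

  sees-unique-colour : (col : Fin n → A) {v p : Fin n} → Adj G v p →
    (∀ y → col y ≡ col p → y ≡ p) → DegreeAtLeast2 G v → SeesTwoColours col v
  sees-unique-colour col vp unique d with other-neighbour G d _
  ... | y , vy , y≢p = _ , y , vp , vy , λ e → y≢p (unique y (sym e))

  dynColorable-by-injection : ∀ {k} (col : Fin n → A) (enc : A → Fin k) →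
    Injective _≡_ _≡_ enc → Dynamic col → DynColorable G k
  dynColorable-by-injection col enc enc-inj (proper , dynamic) =
    (λ v → enc (col v)) ,
    (λ u v uv e → proper u v uv (enc-inj e)) ,
    λ v d → let (a , b , va , vb , a≢b) = dynamic v d in
            a , b , va , vb , λ e → a≢b (enc-inj e)

module Matchings {n} (G : Graph n) where

  Free : ∀ {m} → (l r : Fin m → Fin n) → Fin n → Set
  Free l r v = (∀ i → l i ≢ v) × (∀ i → r i ≢ v)

  extend : ∀ {m} (l r : Fin m → Fin n) → Injective _≡_ _≡_ [ l , r ] →
    (∀ i → Adj G (l i) (r i)) → ∀ {a b} → Free l r a → Free l r b → Adj G a b →
    HasMatching G (suc m)
  extend l r lr-inj edge {a} {b} (la , ra) (lb , rb) ab =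
    l′ , r′ , edge′ , inj′
    where
    l′ r′ : Fin (suc _) → Fin n
    l′ zero = a
    l′ (suc i) = l i
    r′ zero = b
    r′ (suc i) = r i

    edge′ : ∀ i → Adj G (l′ i) (r′ i)
    edge′ zero = ab
    edge′ (suc i) = edge i

    a≢b : a ≢ b
    a≢b = adj⇒≢ G ab

    l≢r : ∀ i j → l i ≢ r j
    l≢r i j e with lr-inj {inj₁ i} {inj₂ j} e
    ... | ()

    inj′ : Injective _≡_ _≡_ [ l′ , r′ ]
    inj′ {inj₁ zero}    {inj₁ zero}    e = refl
    inj′ {inj₁ zero}    {inj₁ (suc j)} e = ⊥-elim (la j (sym e))
    inj′ {inj₁ zero}    {inj₂ zero}    e = ⊥-elim (a≢b e)
    inj′ {inj₁ zero}    {inj₂ (suc j)} e = ⊥-elim (ra j (sym e))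
    inj′ {inj₁ (suc i)} {inj₁ zero}    e = ⊥-elim (la i e)
    inj′ {inj₁ (suc i)} {inj₁ (suc j)} e = cong (λ k → inj₁ (suc k)) (inj₁-injective (lr-inj e))
    inj′ {inj₁ (suc i)} {inj₂ zero}    e = ⊥-elim (lb i e)
    inj′ {inj₁ (suc i)} {inj₂ (suc j)} e = ⊥-elim (l≢r i j e)
    inj′ {inj₂ zero}    {inj₁ zero}    e = ⊥-elim (a≢b (sym e))
    inj′ {inj₂ zero}    {inj₁ (suc j)} e = ⊥-elim (lb j (sym e))
    inj′ {inj₂ zero}    {inj₂ zero}    e = refl
    inj′ {inj₂ zero}    {inj₂ (suc j)} e = ⊥-elim (rb j (sym e))
    inj′ {inj₂ (suc i)} {inj₁ zero}    e = ⊥-elim (ra i e)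
    inj′ {inj₂ (suc i)} {inj₁ (suc j)} e = ⊥-elim (l≢r j i (sym e))
    inj′ {inj₂ (suc i)} {inj₂ zero}    e = ⊥-elim (rb i e)
    inj′ {inj₂ (suc i)} {inj₂ (suc j)} e = cong (λ k → inj₂ (suc k)) (inj₂-injective (lr-inj e))

  module Maximum {m} (l r : Fin m → Fin n) (lr-inj : Injective _≡_ _≡_ [ l , r ])
    (edge : ∀ i → Adj G (l i) (r i)) (maximum : ∀ k → HasMatching G k → k ≤ m) where

    Unmatched : Fin n → Set
    Unmatched = Free l r

    l-injective : ∀ {i j} → l i ≡ l j → i ≡ j
    l-injective e = inj₁-injective (lr-inj e)

    r-injective : ∀ {i j} → r i ≡ r j → i ≡ j
    r-injective e = inj₂-injective (lr-inj e)

    l≢r : ∀ i j → l i ≢ r j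
    l≢r i j e with lr-inj {inj₁ i} {inj₂ j} e
    ... | ()

    no-larger : ¬ HasMatching G (suc m)
    no-larger M = ℕ.n≮n m (maximum (suc m) M)

    unmatched-independent : ∀ {u w} → Unmatched u → Unmatched w → ¬ Adj G u w
    unmatched-independent fu fw uw = no-larger (extend l r lr-inj edge fu fw uw)

    -- There is no augmenting path  w – l j – r j – u  between two distinct
    -- unmatched vertices: replacing the edge j by (l j , w) and adding (r j , u)
    -- would give a larger matching.
    no-short-augmenting-path : ∀ {u w} → Unmatched u → Unmatched w →
      ∀ j → Adj G (l j) w → Adj G (r j) u → w ≡ u
    no-short-augmenting-path {u} {w} (lu , ru) (lw , rw) j lj-w rj-u with w Fin.≟ u
    ... | yes w≡u = w≡u
    ... | no w≢u = ⊥-elim (no-larger (extend l r′ inj′ edge′ free-rj free-u rj-u))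
      where
      r′ : Fin m → Fin n
      r′ k with k Fin.≟ j
      ... | yes _ = w
      ... | no _ = r k

      edge′ : ∀ k → Adj G (l k) (r′ k)
      edge′ k with k Fin.≟ j
      ... | yes refl = lj-w
      ... | no _ = edge k

      inj′ : Injective _≡_ _≡_ [ l , r′ ]
      inj′ {inj₁ i} {inj₁ i′} e = lr-inj e
      inj′ {inj₁ i} {inj₂ k} e with k Fin.≟ j
      ... | yes _ = ⊥-elim (lw i e)
      ... | no _ = ⊥-elim (l≢r i k e)
      inj′ {inj₂ k} {inj₁ i} e with k Fin.≟ j
      ... | yes _ = ⊥-elim (lw i (sym e))
      ... | no _ = ⊥-elim (l≢r i k (sym e))
      inj′ {inj₂ k} {inj₂ k′} e with k Fin.≟ j | k′ Fin.≟ j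
      ... | yes refl | yes refl = refl
      ... | yes _    | no _     = ⊥-elim (rw k′ (sym e))
      ... | no _     | yes _    = ⊥-elim (rw k e)
      ... | no _     | no _     = lr-inj e

      free-rj : Free l r′ (r j)
      free-rj = (λ i → l≢r i j) , λ k → r′-avoids k
        where
        r′-avoids : ∀ k → r′ k ≢ r j
        r′-avoids k with k Fin.≟ j
        ... | yes _ = λ e → rw j (sym e)
        ... | no k≢j = λ e → k≢j (r-injective e)

      free-u : Free l r′ u
      free-u = lu , λ k → r′-avoids k
        where
        r′-avoids : ∀ k → r′ k ≢ u
        r′-avoids k with k Fin.≟ j
        ... | yes _ = w≢u
        ... | no _ = ru k

-- Proper 3-colourings of functional digraphs.  A partial map f on Fin m is read
-- as the digraph with arcs i → j for f i ≡ just j.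

-- Two-colouring by parity along a partial map that strictly decreases a measure
-- μ: the parity of the length of the chain i , g i , g (g i) , … .
module ChainParity {m} (g : Fin m → Maybe (Fin m)) (μ : Fin m → ℕ)
  (decreasing : ∀ {i j} → g i ≡ just j → μ j < μ i) where

  parityWithin : ℕ → Fin m → Bool
  parityWithin zero i = false
  parityWithin (suc fuel) i = maybe′ (λ j → not (parityWithin fuel j)) false (g i)

  -- Fuel beyond μ i does not change the result: the chain is shorter.
  parity-stable : ∀ fuel fuel′ i → μ i < fuel → μ i < fuel′ →
    parityWithin fuel i ≡ parityWithin fuel′ i
  parity-stable (suc fuel) (suc fuel′) i (s≤s μi≤fuel) (s≤s μi≤fuel′) with g i in arc
  ... | nothing = refl
  ... | just j = cong not (parity-stable fuel fuel′ j
          (ℕ.<-≤-trans (decreasing arc) μi≤fuel) (ℕ.<-≤-trans (decreasing arc) μi≤fuel′))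

  parity : Fin m → Bool
  parity i = parityWithin (suc (μ i)) i

  parity-arc : ∀ {i j} → g i ≡ just j → parity i ≡ not (parity j)
  parity-arc {i} {j} arc rewrite arc =
    cong not (parity-stable (μ i) (suc (μ j)) j (decreasing arc) (ℕ.n<1+n (μ j)))

  parity-end : ∀ {i} → g i ≡ nothing → parity i ≡ false
  parity-end end rewrite end = refl

keepIf : ∀ {A : Set} {P : A → Set} → (∀ x → Dec (P x)) → Maybe A → Maybe A
keepIf P? nothing = nothing
keepIf P? (just x) with P? x
... | yes _ = just x
... | no _ = nothing

module _ {A : Set} {P : A → Set} (P? : ∀ x → Dec (P x)) where

  keepIf-kept : ∀ {mx y} → keepIf P? mx ≡ just y → mx ≡ just y × P y
  keepIf-kept {just x} e with P? x
  keepIf-kept {just x} refl | yes p = refl , p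

  keepIf-keeps : ∀ {mx y} → mx ≡ just y → P y → keepIf P? mx ≡ just y
  keepIf-keeps {y = y} refl p with P? y
  ... | yes _ = refl
  ... | no ¬p = ⊥-elim (¬p p)

  keepIf-drops : ∀ {mx y} → mx ≡ just y → ¬ P y → keepIf P? mx ≡ nothing
  keepIf-drops {y = y} refl ¬p with P? y
  ... | yes p = ⊥-elim (¬p p)
  ... | no _ = refl

bit₁ bit₂ : Bool → Fin 3
bit₁ true = suc zero
bit₁ false = zero
bit₂ true = suc (suc zero)
bit₂ false = zero

bit₁-flip : ∀ b → bit₁ (not b) ≢ bit₁ b
bit₁-flip true ()
bit₁-flip false ()

bit₂-flip : ∀ b → bit₂ (not b) ≢ bit₂ b
bit₂-flip true ()
bit₂-flip false ()

bit₁≢bit₂ : ∀ b → bit₁ true ≢ bit₂ b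
bit₁≢bit₂ true ()
bit₁≢bit₂ false ()

bit₂≢bit₁ : ∀ b → bit₂ true ≢ bit₁ b
bit₂≢bit₁ true ()
bit₂≢bit₁ false ()

-- Split the arcs
-- into downward (j < i) and upward (i < j) ones; each kind strictly decreases
-- a measure and is 2-coloured by chain parity.  A vertex with a downward arc is
-- coloured by its downward parity in {0,1}, any other vertex by its upward
-- parity in {0,2}.
module ThreeColouring {m} (f : Fin m → Maybe (Fin m))
  (loopless : ∀ {i j} → f i ≡ just j → j ≢ i) where

  down up : Fin m → Maybe (Fin m)
  down i = keepIf (λ j → toℕ j ℕ.<? toℕ i) (f i)
  up i = keepIf (λ j → toℕ i ℕ.<? toℕ j) (f i)

  module Down = ChainParity down toℕ
    (λ {i} e → proj₂ (keepIf-kept (λ j → toℕ j ℕ.<? toℕ i) {f i} e))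
  module Up = ChainParity up (λ i → m ∸ toℕ i)
    (λ {i} {j} e → ℕ.∸-monoʳ-< (proj₂ (keepIf-kept (λ j → toℕ i ℕ.<? toℕ j) {f i} e))
                               (ℕ.<⇒≤ (FinP.toℕ<n j)))

  col : Fin m → Fin 3
  col i = maybe′ (λ _ → bit₁ (Down.parity i)) (bit₂ (Up.parity i)) (down i)

  col-down : ∀ {i k} → down i ≡ just k → col i ≡ bit₁ (Down.parity i)
  col-down e rewrite e = refl

  col-up : ∀ {i} → down i ≡ nothing → col i ≡ bit₂ (Up.parity i)
  col-up e rewrite e = refl

  down-cases : ∀ j → (∃ λ k → down j ≡ just k) ⊎ down j ≡ nothing
  down-cases j with down j
  ... | just k = inj₁ (k , refl)
  ... | nothing = inj₂ refl

  -- an arc i → j with j < i: col i = bit₁ (not (Down.parity j)), while col j is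
  -- bit₁ (Down.parity j) or, if j has no downward arc, lies in {0,2}
  downward : ∀ {i j} → down i ≡ just j → col i ≢ col j
  downward {i} {j} down-i e with down-cases j
  ... | inj₁ (_ , down-j) = bit₁-flip (Down.parity j) (begin
          bit₁ (not (Down.parity j)) ≡⟨ cong bit₁ (sym (Down.parity-arc down-i)) ⟩
          bit₁ (Down.parity i)       ≡⟨ sym (col-down down-i) ⟩
          col i                      ≡⟨ e ⟩
          col j                      ≡⟨ col-down down-j ⟩
          bit₁ (Down.parity j)       ∎)
    where open ≡-Reasoning
  ... | inj₂ down-j = bit₁≢bit₂ (Up.parity j) (begin
          bit₁ true                  ≡⟨ cong (λ b → bit₁ (not b)) (sym (Down.parity-end down-j)) ⟩
          bit₁ (not (Down.parity j)) ≡⟨ cong bit₁ (sym (Down.parity-arc down-i)) ⟩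
          bit₁ (Down.parity i)       ≡⟨ sym (col-down down-i) ⟩
          col i                      ≡⟨ e ⟩
          col j                      ≡⟨ col-up down-j ⟩
          bit₂ (Up.parity j)         ∎)
    where open ≡-Reasoning

  -- an arc i → j with i < j: col i = bit₂ (not (Up.parity j)), while col j is
  -- bit₂ (Up.parity j) or, if j has a downward (hence no upward) arc, in {0,1}
  upward : ∀ {i j} → down i ≡ nothing → up i ≡ just j → col i ≢ col j
  upward {i} {j} down-i up-i e with down-cases j
  ... | inj₁ (k , down-j) = bit₂≢bit₁ (Down.parity j) (begin
          bit₂ true                ≡⟨ cong (λ b → bit₂ (not b)) (sym (Up.parity-end up-j)) ⟩
          bit₂ (not (Up.parity j)) ≡⟨ cong bit₂ (sym (Up.parity-arc up-i)) ⟩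
          bit₂ (Up.parity i)       ≡⟨ sym (col-up down-i) ⟩
          col i                    ≡⟨ e ⟩
          col j                    ≡⟨ col-down down-j ⟩
          bit₁ (Down.parity j)     ∎)
    where
    open ≡-Reasoning
    up-j : up j ≡ nothing
    up-j with keepIf-kept (λ k → toℕ k ℕ.<? toℕ j) {f j} down-j
    ... | arc , k<j = keepIf-drops (λ k → toℕ j ℕ.<? toℕ k) arc (ℕ.<-asym k<j)
  ... | inj₂ down-j = bit₂-flip (Up.parity j) (begin
          bit₂ (not (Up.parity j)) ≡⟨ cong bit₂ (sym (Up.parity-arc up-i)) ⟩
          bit₂ (Up.parity i)       ≡⟨ sym (col-up down-i) ⟩
          col i                    ≡⟨ e ⟩
          col j                    ≡⟨ col-up down-j ⟩
          bit₂ (Up.parity j)       ∎)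
    where open ≡-Reasoning

  col-proper : ∀ {i j} → f i ≡ just j → col i ≢ col j
  col-proper {i} {j} arc with ℕ.<-cmp (toℕ j) (toℕ i)
  ... | tri< j<i _ _ = downward (keepIf-keeps (λ j → toℕ j ℕ.<? toℕ i) arc j<i)
  ... | tri≈ _ j≡i _ = ⊥-elim (loopless arc (FinP.toℕ-injective j≡i))
  ... | tri> j≮i _ i<j = upward (keepIf-drops (λ j → toℕ j ℕ.<? toℕ i) arc j≮i)
                                (keepIf-keeps (λ j → toℕ i ℕ.<? toℕ j) arc i<j)

three-colouring : ∀ {m} (f : Fin m → Maybe (Fin m)) → (∀ {i j} → f i ≡ just j → j ≢ i) →
  Σ (Fin m → Fin 3) λ col → ∀ {i j} → f i ≡ just j → col i ≢ col j
three-colouring f loopless = col , col-proper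
  where open ThreeColouring f loopless

data Palette (χ m : ℕ) : Set where
  old   : Fin χ → Palette χ m
  priv  : Fin m → Palette χ m
  extra : Fin 3 → Palette χ m

module _ {χ m : ℕ} where

  encode : Palette χ m → Fin (χ + m + 3)
  encode (old a)   = join (χ + m) 3 (inj₁ (join χ m (inj₁ a)))
  encode (priv k)  = join (χ + m) 3 (inj₁ (join χ m (inj₂ k)))
  encode (extra e) = join (χ + m) 3 (inj₂ e)

  decode : Fin (χ + m + 3) → Palette χ m
  decode x = [ (λ y → [ old , priv ] (splitAt χ y)) , extra ] (splitAt (χ + m) x)

  decode-encode : ∀ C → decode (encode C) ≡ C
  decode-encode (old a)
    rewrite FinP.splitAt-join (χ + m) 3 (inj₁ (join χ m (inj₁ a)))
          | FinP.splitAt-join χ m (inj₁ a) = refl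
  decode-encode (priv k)
    rewrite FinP.splitAt-join (χ + m) 3 (inj₁ (join χ m (inj₂ k)))
          | FinP.splitAt-join χ m (inj₂ k) = refl
  decode-encode (extra e) rewrite FinP.splitAt-join (χ + m) 3 (inj₂ e) = refl

  encode-injective : Injective _≡_ _≡_ encode
  encode-injective {C} {D} e = begin
    C                   ≡⟨ sym (decode-encode C) ⟩
    decode (encode C)   ≡⟨ cong decode e ⟩
    decode (encode D)   ≡⟨ decode-encode D ⟩
    D                   ∎
    where open ≡-Reasoning

module Construction {n χ m} (G : Graph n) (c : Fin n → Fin χ) (c-proper : IsProperColoring G c)
  (l r : Fin m → Fin n) (lr-inj : Injective _≡_ _≡_ [ l , r ])
  (edge : ∀ i → Adj G (l i) (r i)) (maximum : ∀ k → HasMatching G k → k ≤ m) where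

  open Matchings.Maximum G l r lr-inj edge maximum
  open Colourings G

  role : ∀ v → (∃ λ i → l i ≡ v) ⊎ (∃ λ i → r i ≡ v) ⊎ Unmatched v
  role v with FinP.any? (λ i → l i Fin.≟ v)
  ... | yes left = inj₁ left
  ... | no not-left with FinP.any? (λ i → r i Fin.≟ v)
  ...   | yes right = inj₂ (inj₁ right)
  ...   | no not-right = inj₂ (inj₂ ((λ i e → not-left (i , e)) , (λ i e → not-right (i , e))))

  unmatched? : ∀ v → Dec (Unmatched v)
  unmatched? v with role v
  ... | inj₁ (i , li≡v) = no λ u → proj₁ u i li≡v
  ... | inj₂ (inj₁ (i , ri≡v)) = no λ u → proj₂ u i ri≡v
  ... | inj₂ (inj₂ u) = yes u

  LeftSeesFree RightSeesFree : Fin m → Set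
  LeftSeesFree i = ∃ λ w → Unmatched w × Adj G (l i) w
  RightSeesFree i = ∃ λ w → Unmatched w × Adj G (r i) w

  -- r i is adjacent to l j for an edge with LeftSeesFree j, or to r j for an
  -- edge without it; that neighbour will carry a private colour.
  RightNearPrivate : Fin m → Set
  RightNearPrivate i = ∃ λ j → (LeftSeesFree j × Adj G (r i) (l j))
                             ⊎ (¬ LeftSeesFree j × Adj G (r i) (r j))

  -- An edge none of whose endpoints is helped by the above.
  Stranded : Fin m → Set
  Stranded i = ¬ LeftSeesFree i × ¬ RightSeesFree i × ¬ RightNearPrivate i

  -- The private colour of edge i goes to l i exactly when LeftPrivate i,
  -- otherwise to r i.
  LeftPrivate : Fin m → Set
  LeftPrivate i = LeftSeesFree i ⊎ Stranded i

  LeftSeesStranded : Fin m → Set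
  LeftSeesStranded i = ∃ λ j → j ≢ i × Stranded j × Adj G (l i) (r j)

  LeftSeesFree? : ∀ i → Dec (LeftSeesFree i)
  RightSeesFree? : ∀ i → Dec (RightSeesFree i)
  RightNearPrivate? : ∀ i → Dec (RightNearPrivate i)
  Stranded? : ∀ i → Dec (Stranded i)
  LeftPrivate? : ∀ i → Dec (LeftPrivate i)
  LeftSeesStranded? : ∀ i → Dec (LeftSeesStranded i)
  LeftSeesFree? i = FinP.any? (λ w → unmatched? w ×-dec adj? G (l i) w)
  RightSeesFree? i = FinP.any? (λ w → unmatched? w ×-dec adj? G (r i) w)
  RightNearPrivate? i = FinP.any? (λ j → (LeftSeesFree? j ×-dec adj? G (r i) (l j))
                                      ⊎-dec (¬? (LeftSeesFree? j) ×-dec adj? G (r i) (r j)))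
  Stranded? i = ¬? (LeftSeesFree? i) ×-dec ¬? (RightSeesFree? i) ×-dec ¬? (RightNearPrivate? i)
  LeftPrivate? i = LeftSeesFree? i ⊎-dec Stranded? i
  LeftSeesStranded? i =
    FinP.any? (λ j → ¬? (j Fin.≟ i) ×-dec Stranded? j ×-dec adj? G (l i) (r j))

  -- The auxiliary functional digraph on the edges: an arc i → j to some
  -- stranded j ≠ i with l i adjacent to r j.  Its 3-colouring supplies the
  -- extra colours of the right endpoints of stranded edges.
  next-of : ∀ {i} → Dec (LeftSeesStranded i) → Maybe (Fin m)
  next-of (yes (j , _)) = just j
  next-of (no _) = nothing

  next : Fin m → Maybe (Fin m)
  next i = next-of (LeftSeesStranded? i)

  next-cases : ∀ i → (∃ λ j → next i ≡ just j × j ≢ i × Stranded j × Adj G (l i) (r j))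
                   ⊎ (next i ≡ nothing × ¬ LeftSeesStranded i)
  next-cases i with LeftSeesStranded? i
  ... | yes (j , s) = inj₁ (j , refl , s)
  ... | no ¬s = inj₂ (refl , ¬s)

  next-loopless : ∀ {i j} → next i ≡ just j → j ≢ i
  next-loopless {i} arc with next-cases i
  ... | inj₁ (k , arc′ , k≢i , _) with trans (sym arc) arc′
  ...   | refl = k≢i
  next-loopless {i} arc | inj₂ (end , _) with trans (sym arc) end
  ... | ()

  col₃ : Fin m → Fin 3
  col₃ = proj₁ (three-colouring next next-loopless)

  col₃-proper : ∀ {i j} → next i ≡ just j → col₃ i ≢ col₃ j
  col₃-proper = proj₂ (three-colouring next next-loopless)

  Colour : Set
  Colour = Palette χ m

  data ColourOf : Fin n → Colour → Set where
    free        : ∀ {v} → Unmatched v → ColourOf v (extra zero)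
    left-priv   : ∀ {i} → LeftPrivate i → ColourOf (l i) (priv i)
    left-old    : ∀ {i} → ¬ LeftPrivate i → ColourOf (l i) (old (c (l i)))
    right-extra : ∀ {i} → Stranded i → ColourOf (r i) (extra (col₃ i))
    right-old   : ∀ {i} → LeftSeesFree i → ColourOf (r i) (old (c (r i)))
    right-priv  : ∀ {i} → ¬ LeftPrivate i → ColourOf (r i) (priv i)

  left-colour : ∀ i → Dec (LeftPrivate i) → Σ Colour (ColourOf (l i))
  left-colour i (yes p) = priv i , left-priv p
  left-colour i (no ¬p) = old (c (l i)) , left-old ¬p

  right-colour : ∀ i → Dec (Stranded i) → Dec (LeftSeesFree i) → Σ Colour (ColourOf (r i))
  right-colour i (yes s) _ = extra (col₃ i) , right-extra s
  right-colour i (no _) (yes lf) = old (c (r i)) , right-old lf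
  right-colour i (no ¬s) (no ¬lf) = priv i , right-priv [ ¬lf , ¬s ]

  colour-at : ∀ v → Σ Colour (ColourOf v)
  colour-at v with role v
  ... | inj₁ (i , refl) = left-colour i (LeftPrivate? i)
  ... | inj₂ (inj₁ (i , refl)) = right-colour i (Stranded? i) (LeftSeesFree? i)
  ... | inj₂ (inj₂ u) = extra zero , free u

  colour : Fin n → Colour
  colour v = proj₁ (colour-at v)

  colour-of : ∀ {v C} → colour v ≡ C → ColourOf v C
  colour-of {v} e = subst (ColourOf v) e (proj₂ (colour-at v))

  free-colour : ∀ {v} → Unmatched v → colour v ≡ extra zero
  free-colour {v} u = at-free (colour-of refl)
    where
    at-free : ∀ {C} → ColourOf v C → C ≡ extra zero
    at-free (free _) = refl
    at-free (left-priv {i} _) = ⊥-elim (proj₁ u i refl)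
    at-free (left-old {i} _) = ⊥-elim (proj₁ u i refl)
    at-free (right-extra {i} _) = ⊥-elim (proj₂ u i refl)
    at-free (right-old {i} _) = ⊥-elim (proj₂ u i refl)
    at-free (right-priv {i} _) = ⊥-elim (proj₂ u i refl)

  left-priv-colour : ∀ {i} → LeftPrivate i → colour (l i) ≡ priv i
  left-priv-colour {i} p = at-left (colour-of refl) refl
    where
    at-left : ∀ {v C} → ColourOf v C → v ≡ l i → C ≡ priv i
    at-left (free u) e = ⊥-elim (proj₁ u i (sym e))
    at-left (left-priv _) e with l-injective e
    ... | refl = refl
    at-left (left-old ¬p) e with l-injective e
    ... | refl = ⊥-elim (¬p p)
    at-left (right-extra {j} _) e = ⊥-elim (l≢r i j (sym e))
    at-left (right-old {j} _) e = ⊥-elim (l≢r i j (sym e))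
    at-left (right-priv {j} _) e = ⊥-elim (l≢r i j (sym e))

  right-priv-colour : ∀ {i} → ¬ LeftPrivate i → colour (r i) ≡ priv i
  right-priv-colour {i} ¬p = at-right (colour-of refl) refl
    where
    at-right : ∀ {v C} → ColourOf v C → v ≡ r i → C ≡ priv i
    at-right (free u) e = ⊥-elim (proj₂ u i (sym e))
    at-right (left-priv {j} _) e = ⊥-elim (l≢r j i e)
    at-right (left-old {j} _) e = ⊥-elim (l≢r j i e)
    at-right (right-extra s) e with r-injective e
    ... | refl = ⊥-elim (¬p (inj₂ s))
    at-right (right-old lf) e with r-injective e
    ... | refl = ⊥-elim (¬p (inj₁ lf))
    at-right (right-priv _) e with r-injective e
    ... | refl = refl

  right-extra-colour : ∀ {i} → Stranded i → colour (r i) ≡ extra (col₃ i)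
  right-extra-colour {i} s = at-right (colour-of refl) refl
    where
    at-right : ∀ {v C} → ColourOf v C → v ≡ r i → C ≡ extra (col₃ i)
    at-right (free u) e = ⊥-elim (proj₂ u i (sym e))
    at-right (left-priv {j} _) e = ⊥-elim (l≢r j i e)
    at-right (left-old {j} _) e = ⊥-elim (l≢r j i e)
    at-right (right-extra _) e with r-injective e
    ... | refl = refl
    at-right (right-old lf) e with r-injective e
    ... | refl = ⊥-elim (proj₁ s lf)
    at-right (right-priv ¬p) e with r-injective e
    ... | refl = ⊥-elim (¬p (inj₂ s))

  old-colour : ∀ {v a} → ColourOf v (old a) → c v ≡ a
  old-colour (left-old _) = refl
  old-colour (right-old _) = refl

  priv-unique : ∀ {x y k} → ColourOf x (priv k) → ColourOf y (priv k) → x ≡ y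
  priv-unique (left-priv _) (left-priv _) = refl
  priv-unique (left-priv p) (right-priv ¬p) = ⊥-elim (¬p p)
  priv-unique (right-priv ¬p) (left-priv p) = ⊥-elim (¬p p)
  priv-unique (right-priv _) (right-priv _) = refl

  ExtraColoured : Fin n → Set
  ExtraColoured v = Unmatched v ⊎ ∃ λ i → r i ≡ v × Stranded i

  extra-colour : ∀ {v e} → ColourOf v (extra e) → ExtraColoured v
  extra-colour (free u) = inj₁ u
  extra-colour (right-extra s) = inj₂ (_ , refl , s)

  extra-independent : ∀ {x y} → ExtraColoured x → ExtraColoured y → ¬ Adj G x y
  extra-independent (inj₁ u) (inj₁ w) xy = unmatched-independent u w xy
  extra-independent {x} (inj₁ u) (inj₂ (_ , refl , s)) xy = proj₁ (proj₂ s) (x , u , adj-sym G xy)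
  extra-independent {y = y} (inj₂ (_ , refl , s)) (inj₁ w) xy = proj₁ (proj₂ s) (y , w , xy)
  extra-independent (inj₂ (_ , refl , s)) (inj₂ (j , refl , s′)) xy =
    proj₂ (proj₂ s) (j , inj₂ (proj₁ s′ , xy))

  -- Two vertices with the same colour are never adjacent: for old colours by
  -- properness of c, for private ones by uniqueness, for extra ones by
  -- independence of the extra-coloured vertices.
  same-colour-nonadjacent : ∀ C {x y} → ColourOf x C → ColourOf y C → ¬ Adj G x y
  same-colour-nonadjacent (old _) cx cy xy = c-proper _ _ xy (trans (old-colour cx) (sym (old-colour cy)))
  same-colour-nonadjacent (priv _) cx cy xy = adj⇒≢ G xy (priv-unique cx cy)
  same-colour-nonadjacent (extra _) cx cy xy = extra-independent (extra-colour cx) (extra-colour cy) xy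

  proper : Proper colour
  proper x y xy e = same-colour-nonadjacent (colour x) (colour-of refl) (colour-of (sym e)) xy

  -- A vertex of degree at least two adjacent to a privately coloured vertex
  -- sees two colours; most cases of dynamicity reduce to this.
  sees-private : ∀ {v p k} → Adj G v p → colour p ≡ priv k →
    DegreeAtLeast2 G v → SeesTwoColours colour v
  sees-private vp cp = sees-unique-colour colour vp
    (λ y e → priv-unique (colour-of (trans e cp)) (colour-of cp))

  differs-from-free : ∀ {w x} → Unmatched w → ¬ ExtraColoured x → colour w ≢ colour x
  differs-from-free u ¬extra e = ¬extra (extra-colour (colour-of (trans (sym e) (free-colour u))))

  left-not-extra : ∀ i → ¬ ExtraColoured (l i)
  left-not-extra i (inj₁ u) = proj₁ u i refl
  left-not-extra i (inj₂ (j , e , _)) = l≢r i j (sym e)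

  right-not-extra : ∀ {i} → LeftSeesFree i → ¬ ExtraColoured (r i)
  right-not-extra {i} lf (inj₁ u) = proj₂ u i refl
  right-not-extra lf (inj₂ (_ , e , s)) with r-injective e
  ... | refl = proj₁ s lf

  isolated-neighbour-not-extra : ∀ {i y} → Stranded i → ¬ LeftSeesStranded i →
    Adj G (l i) y → y ≢ r i → ¬ ExtraColoured y
  isolated-neighbour-not-extra {y = y} s ¬ls ly y≢ri (inj₁ u) = proj₁ s (y , u , ly)
  isolated-neighbour-not-extra {i} s ¬ls ly y≢ri (inj₂ (j , refl , sj)) with j Fin.≟ i
  ... | yes refl = y≢ri refl
  ... | no j≢i = ¬ls (j , j≢i , sj , ly)

  extra-injective : ∀ {a b} → extra {χ} {m} a ≡ extra b → a ≡ b
  extra-injective refl = refl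

  -- l i: if r i is private, done; if l i sees an unmatched w, then w and r i
  -- differ; if edge i is stranded, r i has an extra colour differing from that
  -- of the next stranded neighbour r j (3-colouring), or, if there is none,
  -- from the colour of any other neighbour.
  dynamic-left : ∀ i → DegreeAtLeast2 G (l i) → SeesTwoColours colour (l i)
  dynamic-left i d with LeftPrivate? i
  ... | no ¬p = sees-private (edge i) (right-priv-colour ¬p) d
  ... | yes (inj₁ lf@(w , u , lw)) = w , r i , lw , edge i , differs-from-free u (right-not-extra lf)
  ... | yes (inj₂ s) with next-cases i
  ...   | inj₁ (j , arc , _ , sj , l-rj) = r i , r j , edge i , l-rj , λ e →
            col₃-proper arc (extra-injective (begin
              extra (col₃ i) ≡⟨ sym (right-extra-colour s) ⟩
              colour (r i)   ≡⟨ e ⟩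
              colour (r j)   ≡⟨ right-extra-colour sj ⟩
              extra (col₃ j) ∎))
    where open ≡-Reasoning
  ...   | inj₂ (_ , ¬ls) with other-neighbour G d (r i)
  ...     | y , ly , y≢ri = r i , y , edge i , ly , λ e →
            isolated-neighbour-not-extra s ¬ls ly y≢ri
              (extra-colour (colour-of (trans (sym e) (right-extra-colour s))))

  -- r i: if l i is private, done; if r i sees an unmatched w, then w and l i
  -- differ; otherwise edge i is not stranded only because r i has a neighbour
  -- which is privately coloured.
  dynamic-right : ∀ i → DegreeAtLeast2 G (r i) → SeesTwoColours colour (r i)
  dynamic-right i d with LeftPrivate? i
  ... | yes p = sees-private (adj-sym G (edge i)) (left-priv-colour p) d
  ... | no ¬p with RightSeesFree? i
  ...   | yes (w , u , rw) = w , l i , rw , adj-sym G (edge i) , differs-from-free u (left-not-extra i)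
  ...   | no ¬rf with RightNearPrivate? i
  ...     | yes (j , inj₁ (lfj , r-lj)) = sees-private r-lj (left-priv-colour (inj₁ lfj)) d
  ...     | yes (j , inj₂ (¬lfj , r-rj)) = sees-private r-rj (right-priv-colour [ ¬lfj , ¬sj ]) d
    where
    -- r j is adjacent to r i and ¬ LeftSeesFree i, so j is not stranded
    ¬sj : ¬ Stranded j
    ¬sj sj = proj₂ (proj₂ sj) (i , inj₂ ((λ lf → ¬p (inj₁ lf)) , adj-sym G r-rj))
  ...     | no ¬np = ⊥-elim (¬p (inj₂ ((λ lf → ¬p (inj₁ lf)) , ¬rf , ¬np)))

  -- A non-isolated unmatched vertex v has a matched neighbour a.  If a = l j,
  -- then l j is privately coloured.  If a = r j, then either l j sees some
  -- unmatched w, which must be v itself (no augmenting path), or r j is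
  -- privately coloured.
  dynamic-free : ∀ {v} → Unmatched v → DegreeAtLeast2 G v → SeesTwoColours colour v
  dynamic-free {v} u d@(a , _ , va , _) with role a
  ... | inj₁ (j , refl) = sees-private va (left-priv-colour (inj₁ (v , u , adj-sym G va))) d
  ... | inj₂ (inj₂ ua) = ⊥-elim (unmatched-independent u ua va)
  ... | inj₂ (inj₁ (j , refl)) with LeftSeesFree? j
  ...   | yes lf@(w , uw , lw) with no-short-augmenting-path u uw j lw (adj-sym G va)
  ...     | refl = sees-private (adj-sym G lw) (left-priv-colour (inj₁ lf)) d
  dynamic-free {v} u d@(a , _ , va , _) | inj₂ (inj₁ (j , refl)) | no ¬lf =
    sees-private va (right-priv-colour [ ¬lf , (λ s → proj₁ (proj₂ s) (v , u , adj-sym G va)) ]) d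

  dynamic : Dynamic colour
  dynamic = proper , sees-two
    where
    sees-two : ∀ v → DegreeAtLeast2 G v → SeesTwoColours colour v
    sees-two v with role v
    ... | inj₁ (i , refl) = dynamic-left i
    ... | inj₂ (inj₁ (i , refl)) = dynamic-right i
    ... | inj₂ (inj₂ u) = dynamic-free u

  dynColorable : DynColorable G (χ + m + 3)
  dynColorable = dynColorable-by-injection colour encode encode-injective dynamic

theorem8 : ∀ {n} (G : Graph n) (χ χ₂ α′ : ℕ) →
    IsChromaticNumber G χ → IsDynamicChromaticNumber G χ₂ → IsMatchingNumber G α′ →
    χ₂ ∸ χ ≤ α′ + 3
theorem8 G χ χ₂ α′ ((c , c-proper) , _) (_ , χ₂-minimal) ((l , r , edge , lr-inj) , maximum) =
  begin
    χ₂ ∸ χ          ≤⟨ ℕ.∸-monoˡ-≤ χ (χ₂-minimal (χ + α′ + 3) dynColorable) ⟩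
    χ + α′ + 3 ∸ χ  ≡⟨ cong (_∸ χ) (ℕ.+-assoc χ α′ 3) ⟩
    χ + (α′ + 3) ∸ χ ≡⟨ ℕ.m+n∸m≡n χ (α′ + 3) ⟩
    α′ + 3          ∎
  where
  open ℕ.≤-Reasoning
  open Construction G c c-proper l r lr-inj edge maximum using (dynColorable)
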